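{- For every set supercomposition $I=(I_1,\ldots,I_k)$, $$\Delta(Q_I)=\sum_{i=0}^kQ_{\operatorname{std}(I_1,\ldots,I_i)}\otimes Q_{\operatorname{std}(I_{i+1},\ldots,I_k)}.$$
   Context: $\mathbb{Q}^\theta\langle\langle x\rangle\rangle$: bounded-degree formal power series over $\mathbb{Q}$ in noncommuting $x_1,x_2,\ldots$ and $\theta_1,\theta_2,\ldots$ with $x_i\theta_j=\theta_jx_i$, $\theta_i\theta_j=-\theta_j\theta_i$. A set supercomposition of bidegree $(n,m)$ is a sequence $(I_1,\ldots,I_k)$ of nonempty subsets of $\{0,\ldots,n\}$ with $I_i\cap I_j\subseteq\{0\}$ ($i\ne j$), $\bigcup(I_i\setminus\{0\})=[n]$, $m$ blocks containing $0$ (fermionic). For a monic monomial $u$, relabel its index set order-preservingly onto $[k]$ to get $\theta_{i_1}\cdots\theta_{i_m}x_{j_1}\cdots x_{j_n}$ ($i_1<\cdots<i_m$), and set $I(u)=(I_1,\ldots,I_k)$, $I_r=\{t:j_t=r\}\cup(\{0\}$ if $r\in\{i_1,\ldots,i_m\})$; $M_I=\sum_{I(u)=I}u$. $\operatorname{std}$ of a sequence of subsets of $\mathbb{N}_0$ relabels its nonzero elements order-preservingly onto $[n]$; $M_{()}=Q_{()}=1$. $\Delta$ is the linear coproduct (into the super tensor product) with $\Delta(M_I)=\sum_{i=0}^kM_{\operatorname{std}(I_1,\ldots,I_i)}\otimes M_{\operatorname{std}(I_{i+1},\ldots,I_k)}$. Order: $J$ covers $I$ if $J$ arises by replacing two consecutive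 non-fermionic blocks $I_i,I_{i+1}$ with $\max I_i<\min I_{i+1}$ by $I_i\cup I_{i+1}$; $\preceq$ is the reflexive-transitive closure. $Q_I=\sum_{J\succeq I}M_J$. -}

module Defs where

open import Data.Nat using (ℕ; zero; suc; _≤_; _≡ᵇ_; _<ᵇ_; _⊔_; _⊓_)
import Data.Nat as ℕ
open import Data.Bool using (Bool; true; false; if_then_else_; not; _∧_)
open import Data.List using (List; []; _∷_; [_]; _++_; map; concat; concatMap; length;
  take; drop; upTo; foldr; cartesianProduct; deduplicate)
open import Data.List.Properties using (≡-dec)
open import Data.Bool.ListAction using (any)
open import Data.List.Relation.Unary.All using (All)
open import Data.Product using (_×_; _,_)
open import Data.Unit using (⊤)
open import Relation.Nullary using (Dec)
open import Relation.Binary.PropositionalEquality using (_≡_; _≢_)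

-- A block (a finite subset of ℕ₀) is represented canonically as a strictly
-- increasing list; a set supercomposition as a list of blocks.
Block : Set
Block = List ℕ

SComp : Set
SComp = List Block

Increasing : List ℕ → Set
Increasing []           = ⊤
Increasing (x ∷ [])     = ⊤
Increasing (x ∷ y ∷ ys) = (suc x ≤ y) × Increasing (y ∷ ys)

_∈ᵇ_ : ℕ → Block → Bool
x ∈ᵇ b = any (x ≡ᵇ_) b

countᵇ : {A : Set} → (A → Bool) → List A → ℕ
countᵇ p []       = 0
countᵇ p (a ∷ as) = if p a then suc (countᵇ p as) else countᵇ p as

blocksContaining : ℕ → SComp → ℕ
blocksContaining x I = countᵇ (x ∈ᵇ_) I

-- (I₁,…,I_k) is a set supercomposition of bidegree (n,m):
-- nonempty subsets of {0,…,n}; every x ∈ [n] lies in exactly one block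
-- (so blocks pairwise intersect inside {0} and their nonzero parts cover [n]);
-- exactly m blocks contain 0.
IsSetSupercomposition : ℕ → ℕ → SComp → Set
IsSetSupercomposition n m I =
  All (λ b → (b ≢ []) × Increasing b × All (_≤ n) b) I
  × (∀ x → 1 ≤ x → x ≤ n → blocksContaining x I ≡ 1)
  × (blocksContaining 0 I ≡ m)

fermionic : Block → Bool
fermionic b = 0 ∈ᵇ b

maxB : Block → ℕ
maxB b = foldr _⊔_ 0 b

minB : Block → ℕ
minB []       = 0
minB (x ∷ xs) = foldr _⊓_ x xs

-- std: relabel nonzero elements order-preservingly onto [n]
std : SComp → SComp
std B = map (map rel) B
  where
  rel : ℕ → ℕ
  rel zero    = zero
  rel (suc x) = suc (countᵇ (λ y → (0 <ᵇ y) ∧ (y <ᵇ suc x)) (concat B))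

-- the covers of I: merge two consecutive non-fermionic blocks I_i, I_{i+1}
-- with max I_i < min I_{i+1}; then I_i ∪ I_{i+1} = I_i ++ I_{i+1} as sorted lists.
mergeable : Block → Block → Bool
mergeable a b = not (fermionic a) ∧ not (fermionic b) ∧ (maxB a <ᵇ minB b)

covers : SComp → List SComp
covers []            = []
covers (a ∷ [])      = []
covers (a ∷ b ∷ I)   =
  (if mergeable a b then [ (a ++ b) ∷ I ] else [])
  ++ map (a ∷_) (covers (b ∷ I))

reach : ℕ → SComp → List SComp
reach zero    I = I ∷ []
reach (suc f) I = I ∷ concatMap (reach f) (covers I)

_≟S_ : (I J : SComp) → Dec (I ≡ J)
_≟S_ = ≡-dec (≡-dec ℕ._≟_)

-- {J : I ⪯ J}, without repetitions.  Each cover shortens I by one block,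
-- so length I steps suffice for the reflexive-transitive closure.
upset : SComp → List SComp
upset I = deduplicate _≟S_ (reach (length I) I)

-- Elements of the span of {M_I} (resp. of its tensor square) are written as
-- formal sums: a list L of basis labels stands for Σ_{J ∈ L} M_J
-- (resp. a list of pairs stands for Σ M_A ⊗ M_B).

-- Q_I = Σ_{J ⪰ I} M_J
Q : SComp → List SComp
Q I = upset I

-- Δ(M_J) = Σ_{i=0}^{k} M_{std(J₁…J_i)} ⊗ M_{std(J_{i+1}…J_k)}
ΔM : SComp → List (SComp × SComp)
ΔM J = map (λ i → std (take i J) , std (drop i J)) (upTo (suc (length J)))

ΔQ : SComp → List (SComp × SComp)
ΔQ I = concatMap ΔM (Q I)

ΣQ⊗Q : SComp → List (SComp × SComp)
ΣQ⊗Q I = concatMap (λ i → cartesianProduct (Q (std (take i I))) (Q (std (drop i I))))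
                   (upTo (suc (length I)))

-- If J ⪰ I is cut after i blocks, every merge
-- performed on I stays on one side of the cut, so the cut corresponds to a cut of I after some i′
-- blocks with take i′ I ⪯ take i J and drop i′ I ⪯ drop i J.  Since std relabels order-
-- preservingly, it preserves mergeability, so it maps the up-set of X bijectively onto the up-set
-- of std X; hence the two standardised pieces lie in the up-sets of the standardised pieces of I,
-- and conversely any such pair lifts to a concatenation J = Y₁ ++ Y₂ ⪰ I.  Both sides are
-- multiplicity-free: (std (take i J), std (drop i J)) determines (J, i) because all J ⪰ I have the
-- same underlying sequence concat J = concat I, and on the right the cut index of I is recovered from the size
-- of the first component, as the blocks of I are nonempty.
module Submission where

open import Defs
open import Data.Nat using (ℕ; zero; suc; _≤_; _<_; z≤n; s≤s; _⊔_; _⊓_; _<ᵇ_)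
open import Data.Nat.Properties
open import Data.Bool using (Bool; true; false; not; _∧_; T)
open import Data.List using (List; []; _∷_; _++_; map; concat; concatMap; length; take; drop; upTo;
  cartesianProduct)
open import Data.List.Properties
open import Data.List.Membership.Propositional using (_∈_; find; lose)
open import Data.List.Membership.Propositional.Properties
open import Data.List.Membership.Propositional.Properties.WithK using (unique∧set⇒bag)
open import Data.List.Relation.Binary.BagAndSetEquality using (∼bag⇒↭)
open import Data.List.Relation.Binary.Permutation.Propositional using (_↭_)
open import Data.List.Relation.Binary.Subset.Propositional using (_⊆_)
open import Data.List.Relation.Binary.Subset.Propositional.Properties using (xs⊆xs++ys; xs⊆ys++xs)
open import Data.List.Relation.Unary.Any using (here; there)
open import Data.List.Relation.Unary.All as All using (All; []; _∷_)
open import Data.List.Relation.Unary.All.Properties as All using ()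
open import Data.List.Relation.Unary.Unique.Propositional using (Unique; []; _∷_)
import Data.List.Relation.Unary.Unique.Propositional.Properties as Unique
open import Data.List.Relation.Unary.Unique.DecPropositional.Properties _≟S_ using (deduplicate-!)
open import Data.Product using (∃; _×_; _,_; proj₁; proj₂)
open import Data.Sum using (_⊎_; inj₁; inj₂)
open import Data.Empty using (⊥-elim)
open import Relation.Nullary using (¬_)
open import Relation.Nullary.Reflects using (det; fromEquivalence)
open import Function using (_∘_; id)
open import Function.Bundles using (mk⇔)
open import Relation.Binary.PropositionalEquality
open import Relation.Binary.Construct.Closure.ReflexiveTransitive using (Star; ε; _◅_; _◅◅_; gmap)

private
  variable
    A B : Set
    xs : List A

Unique-↭ : {xs ys : List A} → Unique xs → Unique ys → xs ⊆ ys → ys ⊆ xs → xs ↭ ys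
Unique-↭ uxs uys xs⊆ys ys⊆xs = ∼bag⇒↭ (unique∧set⇒bag uxs uys (mk⇔ xs⊆ys ys⊆xs))

Unique-map⁺ : (f : A → B) → (∀ {x y} → x ∈ xs → y ∈ xs → f x ≡ f y → x ≡ y) →
  Unique xs → Unique (map f xs)
Unique-map⁺ f inj [] = []
Unique-map⁺ f inj (x∉ ∷ u) =
  All.map⁺ (All.tabulate λ y∈ e → All.lookup x∉ y∈ (inj (here refl) (there y∈) e))
  ∷ Unique-map⁺ f (λ x∈ y∈ → inj (there x∈) (there y∈)) u

Unique-concatMap⁺ : (f : A → List B) → Unique xs → (∀ {x} → x ∈ xs → Unique (f x)) →
  (∀ {x x′ y} → x ∈ xs → x′ ∈ xs → y ∈ f x → y ∈ f x′ → x ≡ x′) →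
  Unique (concatMap f xs)
Unique-concatMap⁺ f [] _ _ = []
Unique-concatMap⁺ f (x∉ ∷ u) uf disj =
  Unique.++⁺ (uf (here refl))
    (Unique-concatMap⁺ f u (uf ∘ there) (λ x∈ x′∈ → disj (there x∈) (there x′∈)))
    λ (y∈fx , y∈rest) → let x′ , x′∈ , y∈fx′ = find (∈-concatMap⁻ f y∈rest) in
      All.lookup x∉ x′∈ (disj (here refl) (there x′∈) y∈fx y∈fx′)

take-length-++ : (xs ys : List A) → take (length xs) (xs ++ ys) ≡ xs
take-length-++ []       ys = refl
take-length-++ (x ∷ xs) ys = cong (x ∷_) (take-length-++ xs ys)

drop-length-++ : (xs ys : List A) → drop (length xs) (xs ++ ys) ≡ ys
drop-length-++ []       ys = refl
drop-length-++ (x ∷ xs) ys = drop-length-++ xs ys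

++-cancel-length : (xs xs′ ys ys′ : List A) → length xs ≡ length xs′ →
  xs ++ ys ≡ xs′ ++ ys′ → xs ≡ xs′ × ys ≡ ys′
++-cancel-length []       []         ys ys′ _ e = refl , e
++-cancel-length (x ∷ xs) (x′ ∷ xs′) ys ys′ l e with refl , e′ ← ∷-injective e
  with refl , ys≡ys′ ← ++-cancel-length xs xs′ ys ys′ (suc-injective l) e′ = refl , ys≡ys′

-- The order ⪯ on set supercompositions

infix 4 _⋖_ _⪯_

data _⋖_ : SComp → SComp → Set where
  merge : ∀ {a b I} → mergeable a b ≡ true → a ∷ b ∷ I ⋖ (a ++ b) ∷ I
  skip  : ∀ {a I J} → I ⋖ J → a ∷ I ⋖ a ∷ J

_⪯_ : SComp → SComp → Set
_⪯_ = Star _⋖_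

∈-covers⁻ : ∀ I {J} → J ∈ covers I → I ⋖ J
∈-covers⁻ (a ∷ b ∷ I) J∈ with mergeable a b in eq
... | true  with J∈
...   | here refl = merge eq
...   | there J∈′ with _ , J′∈ , refl ← ∈-map⁻ (a ∷_) J∈′ = skip (∈-covers⁻ (b ∷ I) J′∈)
∈-covers⁻ (a ∷ b ∷ I) J∈ | false with _ , J′∈ , refl ← ∈-map⁻ (a ∷_) J∈ =
  skip (∈-covers⁻ (b ∷ I) J′∈)

∈-covers⁺ : ∀ {I J} → I ⋖ J → J ∈ covers I
∈-covers⁺ (merge eq) rewrite eq = here refl
∈-covers⁺ (skip {a} {b ∷ I} I⋖J) with mergeable a b
... | true  = there (∈-map⁺ (a ∷_) (∈-covers⁺ I⋖J))
... | false = ∈-map⁺ (a ∷_) (∈-covers⁺ I⋖J)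

⋖-length : ∀ {I J} → I ⋖ J → length I ≡ suc (length J)
⋖-length (merge _)  = refl
⋖-length (skip I⋖J) = cong suc (⋖-length I⋖J)

∈-reach⁻ : ∀ f I {J} → J ∈ reach f I → I ⪯ J
∈-reach⁻ zero    I (here refl) = ε
∈-reach⁻ (suc f) I (here refl) = ε
∈-reach⁻ (suc f) I (there J∈) with K , K∈ , J∈′ ← find (∈-concatMap⁻ (reach f) J∈) =
  ∈-covers⁻ I K∈ ◅ ∈-reach⁻ f K J∈′

∈-reach⁺ : ∀ f {I J} → length I ≤ f → I ⪯ J → J ∈ reach f I
∈-reach⁺ zero    _  ε = here refl
∈-reach⁺ (suc f) _  ε = here refl
∈-reach⁺ zero    le (I⋖K ◅ _) with () ← subst (_≤ 0) (⋖-length I⋖K) le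
∈-reach⁺ (suc f) le (I⋖K ◅ K⪯J) =
  there (∈-concatMap⁺ (reach f) (lose (∈-covers⁺ I⋖K)
    (∈-reach⁺ f (≤-pred (subst (_≤ suc f) (⋖-length I⋖K) le)) K⪯J)))

∈-Q⁻ : ∀ I {J} → J ∈ Q I → I ⪯ J
∈-Q⁻ I J∈ = ∈-reach⁻ (length I) I (∈-deduplicate⁻ _≟S_ (reach (length I) I) J∈)

∈-Q⁺ : ∀ {I J} → I ⪯ J → J ∈ Q I
∈-Q⁺ {I} I⪯J = ∈-deduplicate⁺ _≟S_ (∈-reach⁺ (length I) ≤-refl I⪯J)

⋖-concat : ∀ {I J} → I ⋖ J → concat I ≡ concat J
⋖-concat (merge {a} {b} {I} _) = sym (++-assoc a b (concat I))
⋖-concat (skip {a} I⋖J)        = cong (a ++_) (⋖-concat I⋖J)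

⪯-concat : ∀ {I J} → I ⪯ J → concat I ≡ concat J
⪯-concat ε         = refl
⪯-concat (s ◅ I⪯J) = trans (⋖-concat s) (⪯-concat I⪯J)

⋖-++ʳ : ∀ {I I′} J → I ⋖ I′ → I ++ J ⋖ I′ ++ J
⋖-++ʳ J (merge eq) = merge eq
⋖-++ʳ J (skip s)   = skip (⋖-++ʳ J s)

⋖-++ˡ : ∀ I {J J′} → J ⋖ J′ → I ++ J ⋖ I ++ J′
⋖-++ˡ []      s = s
⋖-++ˡ (a ∷ I) s = skip (⋖-++ˡ I s)

⪯-++ : ∀ {I I′ J J′} → I ⪯ I′ → J ⪯ J′ → I ++ J ⪯ I′ ++ J′
⪯-++ {I′ = I′} {J} I⪯I′ J⪯J′ = gmap (_++ J) (⋖-++ʳ J) I⪯I′ ◅◅ gmap (I′ ++_) (⋖-++ˡ I′) J⪯J′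

CutsAt : SComp → SComp → ℕ → Set
CutsAt I J i = ∃ λ i′ → i′ ≤ length I × take i′ I ⪯ take i J × drop i′ I ⪯ drop i J

⋖-cut : ∀ {I J} → I ⋖ J → ∀ i → i ≤ length J → CutsAt I J i
⋖-cut s            zero    _        = 0 , z≤n , ε , s ◅ ε
⋖-cut (merge eq)   (suc i) (s≤s le) = suc (suc i) , s≤s (s≤s le) , merge eq ◅ ε , ε
⋖-cut (skip {a} s) (suc i) (s≤s le) with i′ , le′ , t , d ← ⋖-cut s i le =
  suc i′ , s≤s le′ , gmap (a ∷_) skip t , d

⪯-cut : ∀ {I J} → I ⪯ J → ∀ i → i ≤ length J → CutsAt I J i
⪯-cut ε         i le = i , le , ε , ε
⪯-cut (s ◅ K⪯J) i le with k , k≤ , t₂ , d₂ ← ⪯-cut K⪯J i le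
  with i′ , i′≤ , t₁ , d₁ ← ⋖-cut s k k≤ = i′ , i′≤ , t₁ ◅◅ t₂ , d₁ ◅◅ d₂

-- Order-preserving relabelling

countᵇ-mono : (p q : A → Bool) → (∀ z → T (p z) → T (q z)) → ∀ zs → countᵇ p zs ≤ countᵇ q zs
countᵇ-mono p q p⇒q []       = z≤n
countᵇ-mono p q p⇒q (z ∷ zs) with p z | q z | p⇒q z
... | true  | true  | _  = s≤s (countᵇ-mono p q p⇒q zs)
... | true  | false | pq = ⊥-elim (pq _)
... | false | true  | _  = m≤n⇒m≤1+n (countᵇ-mono p q p⇒q zs)
... | false | false | _  = countᵇ-mono p q p⇒q zs

countᵇ-< : (p q : A → Bool) → (∀ z → T (p z) → T (q z)) → ∀ {w} zs → w ∈ zs →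
  ¬ T (p w) → T (q w) → countᵇ p zs < countᵇ q zs
countᵇ-< p q p⇒q (z ∷ zs) (here refl) ¬pz qz with p z | q z
... | true  | _     = ⊥-elim (¬pz _)
... | false | false = ⊥-elim qz
... | false | true  = s≤s (countᵇ-mono p q p⇒q zs)
countᵇ-< p q p⇒q (z ∷ zs) (there w∈) ¬pw qw with p z | q z | p⇒q z
... | true  | true  | _  = s≤s (countᵇ-< p q p⇒q zs w∈ ¬pw qw)
... | true  | false | pq = ⊥-elim (pq _)
... | false | true  | _  = m≤n⇒m≤1+n (countᵇ-< p q p⇒q zs w∈ ¬pw qw)
... | false | false | _  = countᵇ-< p q p⇒q zs w∈ ¬pw qw

below : ℕ → ℕ → Bool
below x y = (0 <ᵇ y) ∧ (y <ᵇ suc x)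

relabel : List ℕ → ℕ → ℕ
relabel S zero    = zero
relabel S (suc x) = suc (countᵇ (below x) S)

relabelBlocks : List ℕ → SComp → SComp
relabelBlocks S = map (map (relabel S))

std-relabel : ∀ I → std I ≡ relabelBlocks (concat I) I
std-relabel I = map-cong (map-cong λ { zero → refl ; (suc x) → refl }) I

below-mono : ∀ {x y} → x ≤ y → ∀ z → T (below x z) → T (below y z)
below-mono x≤y z z<x with 0 <ᵇ z
... | true  = <⇒<ᵇ (≤-trans (<ᵇ⇒< z _ z<x) (s≤s x≤y))
... | false = z<x

relabel-mono : ∀ S {x y} → x ≤ y → relabel S x ≤ relabel S y
relabel-mono S {zero}  _         = z≤n
relabel-mono S {suc x} (s≤s x≤y) = s≤s (countᵇ-mono (below x) _ (below-mono x≤y) S)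

relabel-< : ∀ S {x y} → x ≡ 0 ⊎ x ∈ S → x < y → relabel S x < relabel S y
relabel-< S {zero}  {suc y} _         _         = s≤s z≤n
relabel-< S {suc x} {suc y} (inj₂ x∈) (s≤s x<y) =
  s≤s (countᵇ-< (below x) _ (below-mono (<⇒≤ x<y)) S x∈ (λ x<x → <-irrefl refl (<ᵇ⇒< x x x<x))
    (<⇒<ᵇ x<y))

relabel-<ᵇ : ∀ S {x} y → x ≡ 0 ⊎ x ∈ S → (relabel S x <ᵇ relabel S y) ≡ (x <ᵇ y)
relabel-<ᵇ S {x} y x∈ = det (<ᵇ-reflects-< _ _)
  (fromEquivalence (relabel-< S x∈ ∘ <ᵇ⇒< x y)
    λ rx<ry → <⇒<ᵇ (≰⇒> λ y≤x → <⇒≱ rx<ry (relabel-mono S y≤x)))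

maxB-relabel : ∀ S a → maxB (map (relabel S) a) ≡ relabel S (maxB a)
maxB-relabel S a = trans (foldr-map _⊔_ (relabel S) 0 a)
  (sym (foldr-fusion (relabel S) 0 (mono-≤-distrib-⊔ (relabel-mono S)) a))

minB-relabel : ∀ S a → minB (map (relabel S) a) ≡ relabel S (minB a)
minB-relabel S []      = refl
minB-relabel S (x ∷ a) = trans (foldr-map _⊓_ (relabel S) (relabel S x) a)
  (sym (foldr-fusion (relabel S) x (mono-≤-distrib-⊓ (relabel-mono S)) a))

fermionic-relabel : ∀ S a → fermionic (map (relabel S) a) ≡ fermionic a
fermionic-relabel S []          = refl
fermionic-relabel S (zero ∷ a)  = refl
fermionic-relabel S (suc x ∷ a) = fermionic-relabel S a

mergeable-relabel : ∀ S a b → a ⊆ S →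
  mergeable (map (relabel S) a) (map (relabel S) b) ≡ mergeable a b
mergeable-relabel S a b a⊆S
  rewrite fermionic-relabel S a | fermionic-relabel S b | maxB-relabel S a | minB-relabel S b
  = cong (λ t → not (fermionic a) ∧ not (fermionic b) ∧ t) (relabel-<ᵇ S (minB b) max∈)
  where
  max∈ : maxB a ≡ 0 ⊎ maxB a ∈ S
  max∈ with foldr-selective ⊔-sel 0 a
  ... | inj₁ max≡0 = inj₁ max≡0
  ... | inj₂ max∈a = inj₂ (a⊆S max∈a)

⋖-relabel : ∀ S {I J} → concat I ⊆ S → I ⋖ J → relabelBlocks S I ⋖ relabelBlocks S J
⋖-relabel S {a ∷ b ∷ I} I⊆S (merge eq) rewrite map-++ (relabel S) a b =
  merge (trans (mergeable-relabel S a b (I⊆S ∘ xs⊆xs++ys a _)) eq)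
⋖-relabel S {a ∷ I} I⊆S (skip s) = skip (⋖-relabel S (I⊆S ∘ xs⊆ys++xs _ a) s)

⪯-relabel : ∀ S {I J} → concat I ⊆ S → I ⪯ J → relabelBlocks S I ⪯ relabelBlocks S J
⪯-relabel S I⊆S ε         = ε
⪯-relabel S I⊆S (s ◅ K⪯J) =
  ⋖-relabel S I⊆S s ◅ ⪯-relabel S (I⊆S ∘ subst (_ ∈_) (sym (⋖-concat s))) K⪯J

⋖-unrelabel : ∀ S I {K} → concat I ⊆ S → relabelBlocks S I ⋖ K →
  ∃ λ J → I ⋖ J × relabelBlocks S J ≡ K
⋖-unrelabel S (a ∷ b ∷ I) I⊆S (merge eq) =
  (a ++ b) ∷ I , merge (trans (sym (mergeable-relabel S a b (I⊆S ∘ xs⊆xs++ys a _))) eq) ,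
  cong (_∷ relabelBlocks S I) (map-++ (relabel S) a b)
⋖-unrelabel S (a ∷ I) I⊆S (skip s) with J , I⋖J , eq ← ⋖-unrelabel S I (I⊆S ∘ xs⊆ys++xs _ a) s =
  a ∷ J , skip I⋖J , cong (map (relabel S) a ∷_) eq

⪯-unrelabel : ∀ S I {K} → concat I ⊆ S → relabelBlocks S I ⪯ K →
  ∃ λ J → I ⪯ J × relabelBlocks S J ≡ K
⪯-unrelabel S I I⊆S ε = I , ε , refl
⪯-unrelabel S I I⊆S (s ◅ L⪯K) with J₁ , I⋖J₁ , refl ← ⋖-unrelabel S I I⊆S s
  with J , J₁⪯J , eq ← ⪯-unrelabel S J₁ (I⊆S ∘ subst (_ ∈_) (sym (⋖-concat I⋖J₁))) L⪯K =
  J , I⋖J₁ ◅ J₁⪯J , eq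

std-relabel-⪯ : ∀ {I J} → I ⪯ J → std J ≡ relabelBlocks (concat I) J
std-relabel-⪯ {I} {J} I⪯J = trans (std-relabel J) (cong (λ S → relabelBlocks S J) (sym (⪯-concat I⪯J)))

std-mono : ∀ {I J} → I ⪯ J → std I ⪯ std J
std-mono {I} I⪯J =
  subst₂ _⪯_ (sym (std-relabel I)) (sym (std-relabel-⪯ I⪯J)) (⪯-relabel (concat I) id I⪯J)

std-lift : ∀ I {K} → std I ⪯ K → ∃ λ J → I ⪯ J × std J ≡ K
std-lift I std⪯K with J , I⪯J , eq ← ⪯-unrelabel (concat I) I id (subst (_⪯ _) (std-relabel I) std⪯K) =
  J , I⪯J , trans (std-relabel-⪯ I⪯J) eq

-- Injectivity of standardisation

size : SComp → ℕ
size I = length (concat I)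

size-std : ∀ I → size (std I) ≡ size I
size-std I rewrite std-relabel I = trans (cong length (concat-map I)) (length-map _ (concat I))

⪯-size : ∀ {I J} → I ⪯ J → size I ≡ size J
⪯-size = cong length ∘ ⪯-concat

map-length-std : ∀ I → map length (std I) ≡ map length I
map-length-std I rewrite std-relabel I = trans (sym (map-∘ I)) (map-cong (length-map _) I)

map-length-concat-injective : ∀ (I J : SComp) → map length I ≡ map length J →
  concat I ≡ concat J → I ≡ J
map-length-concat-injective []      []      _ _ = refl
map-length-concat-injective (a ∷ I) (b ∷ J) l c
  with l₁ , l₂ ← ∷-injective l with refl , c′ ← ++-cancel-length a b (concat I) (concat J) l₁ c =
  cong (a ∷_) (map-length-concat-injective I J l₂ c′)

std-injective : ∀ I J → std I ≡ std J → concat I ≡ concat J → I ≡ J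
std-injective I J e = map-length-concat-injective I J
  (trans (sym (map-length-std I)) (trans (cong (map length) e) (map-length-std J)))

cut : SComp → ℕ → SComp × SComp
cut J i = std (take i J) , std (drop i J)

cut-injective : ∀ J J′ {i i′} → concat J ≡ concat J′ → i ≤ length J → i′ ≤ length J′ →
  cut J i ≡ cut J′ i′ → J ≡ J′ × i ≡ i′
cut-injective J J′ {i} {i′} c i≤ i′≤ e = J≡J′ , i≡i′
  where
  P D P′ D′ : SComp
  P = take i J; D = drop i J; P′ = take i′ J′; D′ = drop i′ J′
  splits : concat P ++ concat D ≡ concat P′ ++ concat D′
  splits = begin
    concat P ++ concat D   ≡⟨ concat-++ P D ⟩
    concat (P ++ D)        ≡⟨ cong concat (take++drop≡id i J) ⟩
    concat J               ≡⟨ c ⟩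
    concat J′              ≡⟨ cong concat (take++drop≡id i′ J′) ⟨
    concat (P′ ++ D′)      ≡⟨ concat-++ P′ D′ ⟨
    concat P′ ++ concat D′ ∎
    where open ≡-Reasoning
  sizeP : size P ≡ size P′
  sizeP = trans (sym (size-std P)) (trans (cong (size ∘ proj₁) e) (size-std P′))
  pieces : concat P ≡ concat P′ × concat D ≡ concat D′
  pieces = ++-cancel-length (concat P) (concat P′) (concat D) (concat D′) sizeP splits
  P≡P′ : P ≡ P′
  P≡P′ = std-injective P P′ (cong proj₁ e) (proj₁ pieces)
  J≡J′ : J ≡ J′
  J≡J′ = begin
    J        ≡⟨ take++drop≡id i J ⟨
    P ++ D   ≡⟨ cong₂ _++_ P≡P′ (std-injective D D′ (cong proj₂ e) (proj₂ pieces)) ⟩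
    P′ ++ D′ ≡⟨ take++drop≡id i′ J′ ⟩
    J′       ∎
    where open ≡-Reasoning
  i≡i′ : i ≡ i′
  i≡i′ = begin
    i              ≡⟨ m≤n⇒m⊓n≡m i≤ ⟨
    i ⊓ length J   ≡⟨ length-take i J ⟨
    length P       ≡⟨ cong length P≡P′ ⟩
    length P′      ≡⟨ length-take i′ J′ ⟩
    i′ ⊓ length J′ ≡⟨ m≤n⇒m⊓n≡m i′≤ ⟩
    i′             ∎
    where open ≡-Reasoning

take-size-injective : ∀ I → All (_≢ []) I → ∀ {i i′} → i ≤ length I → i′ ≤ length I →
  size (take i I) ≡ size (take i′ I) → i ≡ i′
take-size-injective _              _          {zero}  {zero}   _ _ _ = refl
take-size-injective ([] ∷ _)       (a≢[] ∷ _) {suc _} {_}      _ _ _ = ⊥-elim (a≢[] refl)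
take-size-injective ([] ∷ _)       (a≢[] ∷ _) {zero}  {suc _}  _ _ _ = ⊥-elim (a≢[] refl)
take-size-injective ((x ∷ a) ∷ I)  _          {zero}  {suc _}  _ _ ()
take-size-injective ((x ∷ a) ∷ I)  _          {suc _} {zero}   _ _ ()
take-size-injective ((x ∷ a) ∷ I)  (_ ∷ ne)   {suc i} {suc i′} (s≤s i≤) (s≤s i′≤) e =
  cong suc (take-size-injective I ne i≤ i′≤ (+-cancelˡ-≡ (length (x ∷ a)) _ _
    (trans (sym (length-++ (x ∷ a))) (trans e (length-++ (x ∷ a))))))

∈-upTo-suc⁻ : ∀ {i n} → i ∈ upTo (suc n) → i ≤ n
∈-upTo-suc⁻ = ≤-pred ∘ ∈-upTo⁻

∈-ΔM-++ : ∀ J₁ J₂ → (std J₁ , std J₂) ∈ ΔM (J₁ ++ J₂)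
∈-ΔM-++ J₁ J₂ = subst (_∈ ΔM (J₁ ++ J₂)) cut-++ (∈-map⁺ (cut (J₁ ++ J₂)) (∈-upTo⁺ (s≤s J₁≤)))
  where
  cut-++ : cut (J₁ ++ J₂) (length J₁) ≡ (std J₁ , std J₂)
  cut-++ = cong₂ _,_ (cong std (take-length-++ J₁ J₂)) (cong std (drop-length-++ J₁ J₂))
  J₁≤ : length J₁ ≤ length (J₁ ++ J₂)
  J₁≤ = subst (length J₁ ≤_) (sym (length-++ J₁)) (m≤m+n _ _)

cutQ : SComp → ℕ → List (SComp × SComp)
cutQ I i = cartesianProduct (Q (std (take i I))) (Q (std (drop i I)))

ΔQ⊆ΣQ⊗Q : ∀ I → ΔQ I ⊆ ΣQ⊗Q I
ΔQ⊆ΣQ⊗Q I z∈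
  with J , J∈ , z∈ΔM ← find (∈-concatMap⁻ ΔM z∈)
  with i , i∈ , refl ← ∈-map⁻ (cut J) z∈ΔM
  with i′ , i′≤ , t , d ← ⪯-cut (∈-Q⁻ I J∈) i (∈-upTo-suc⁻ i∈) =
  ∈-concatMap⁺ (cutQ I) (lose (∈-upTo⁺ (s≤s i′≤))
    (∈-cartesianProduct⁺ (∈-Q⁺ (std-mono t)) (∈-Q⁺ (std-mono d))))

ΣQ⊗Q⊆ΔQ : ∀ I → ΣQ⊗Q I ⊆ ΔQ I
ΣQ⊗Q⊆ΔQ I z∈
  with i , _ , z∈cutQ ← find (∈-concatMap⁻ (cutQ I) {upTo (suc (length I))} z∈)
  with A∈ , B∈ ← ∈-cartesianProduct⁻ (Q (std (take i I))) (Q (std (drop i I))) z∈cutQ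
  with J₁ , t , refl ← std-lift (take i I) (∈-Q⁻ _ A∈)
  with J₂ , d , refl ← std-lift (drop i I) (∈-Q⁻ _ B∈) =
  ∈-concatMap⁺ ΔM (lose (∈-Q⁺ (subst (_⪯ J₁ ++ J₂) (take++drop≡id i I) (⪯-++ t d))) (∈-ΔM-++ J₁ J₂))

Q-unique : ∀ I → Unique (Q I)
Q-unique I = deduplicate-! (reach (length I) I)

ΔM-unique : ∀ J → Unique (ΔM J)
ΔM-unique J = Unique-map⁺ (cut J)
  (λ i∈ i′∈ e → proj₂ (cut-injective J J refl (∈-upTo-suc⁻ i∈) (∈-upTo-suc⁻ i′∈) e))
  (Unique.upTo⁺ _)

ΔQ-unique : ∀ I → Unique (ΔQ I)
ΔQ-unique I = Unique-concatMap⁺ ΔM (Q-unique I) (λ _ → ΔM-unique _) disjoint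
  where
  disjoint : ∀ {J J′ z} → J ∈ Q I → J′ ∈ Q I → z ∈ ΔM J → z ∈ ΔM J′ → J ≡ J′
  disjoint J∈ J′∈ z∈ z∈′ with i , i∈ , refl ← ∈-map⁻ (cut _) z∈ | i′ , i′∈ , e ← ∈-map⁻ (cut _) z∈′ =
    proj₁ (cut-injective _ _ (trans (sym (⪯-concat (∈-Q⁻ I J∈))) (⪯-concat (∈-Q⁻ I J′∈)))
      (∈-upTo-suc⁻ i∈) (∈-upTo-suc⁻ i′∈) e)

ΣQ⊗Q-unique : ∀ I → All (_≢ []) I → Unique (ΣQ⊗Q I)
ΣQ⊗Q-unique I nonempty = Unique-concatMap⁺ (cutQ I) (Unique.upTo⁺ (suc (length I)))
  (λ {i} _ → Unique.cartesianProduct⁺ (Q-unique (std (take i I))) (Q-unique (std (drop i I))))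
  disjoint
  where
  disjoint : ∀ {i i′ z} → i ∈ upTo (suc (length I)) → i′ ∈ upTo (suc (length I)) →
    z ∈ cutQ I i → z ∈ cutQ I i′ → i ≡ i′
  disjoint {i} {i′} {A , _} i∈ i′∈ z∈ z∈′ =
    take-size-injective I nonempty (∈-upTo-suc⁻ i∈) (∈-upTo-suc⁻ i′∈) (begin
      size (take i I)        ≡⟨ size-std (take i I) ⟨
      size (std (take i I))  ≡⟨ ⪯-size (∈-Q⁻ _ (first∈ i z∈)) ⟩
      size A                 ≡⟨ ⪯-size (∈-Q⁻ _ (first∈ i′ z∈′)) ⟨
      size (std (take i′ I)) ≡⟨ size-std (take i′ I) ⟩
      size (take i′ I)       ∎)
    where
    open ≡-Reasoning
    first∈ : ∀ i {z} → z ∈ cutQ I i → proj₁ z ∈ Q (std (take i I))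
    first∈ i = proj₁ ∘ ∈-cartesianProduct⁻ (Q (std (take i I))) (Q (std (drop i I)))

proposition5p4 : (n m : ℕ) (I : SComp) → IsSetSupercomposition n m I →
    ΔQ I ↭ ΣQ⊗Q I
proposition5p4 _ _ I (blocks , _ , _) =
  Unique-↭ (ΔQ-unique I) (ΣQ⊗Q-unique I (All.map proj₁ blocks)) (ΔQ⊆ΣQ⊗Q I) (ΣQ⊗Q⊆ΔQ I)
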